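{- Let $\pi\in\mathcal D(n)$ have bounce points $0=b_0,b_1,\dots,b_m=n$, and suppose that for some $1\le i\le m-1$ the column $b_i$ has height $h_{b_i}=b_{i+1}$. Then there exists $1\le j\le i$ such that $\pi\cdot U_j\neq\bot$.
   Context: A Dyck path of semilength $n$ is a lattice path from $(0,0)$ to $(n,n)$ with unit north and east steps never going below $y=x$; $\mathcal D(n)$ is their set. Row $j$ is the strip $j-1\le y\le j$, column $i$ the strip $i-1\le x\le i$. For a path let $x_j$ be the $x$-coordinate of its north step in row $j$ and $h_i$ the $y$-coordinate of its east step in column $i$ (the height of column $i$); set $h_0=0$. Bounce points: $b_0=0$, $b_k=h_{b_{k-1}+1}$ until $b_m=n$. Operators act on the right on $\mathcal D(n)\cup\{\bot\}$, composed left to right, fixing $\bot$; $X^{ -k}=(X^{ -1})^k$, $X^0=\mathrm{id}$. $A_i$ / $A_i^{ -1}$ replace $x_i$ by $x_i\mp1$; $C_i$ / $C_i^{ -1}$ replace $h_i$ by $h_i\pm1$; result $\bot$ if not a Dyck path. Operator $U_i$ ($1\le i\le m$): let $u=0$ if $i=m$ and $u=b_{i+1}-h_{b_i}$ otherwise, and $\beta_j=h_{b_{i-1}+u+2-j}-b_i+1$ for $1\le j\le u$. If $h_{b_{i-1}}=b_i$ then $\pi\cdot U_i=\bot$; otherwise $\pi\cdot U_i=\pi\cdot C_{b_{i-1}+1}^{ -1}\,C_{b_{i-1}+2}^{ -\beta_u}\cdots C_{b_{i-1}+1+u}^{ -\beta_1}\,A_{b_{i+1}-u+1}^{\beta_1}\cdots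 A_{b_{i+1}}^{\beta_u}$ (which may be $\bot$). -}

module Defs where

open import Data.Nat using (ℕ; zero; suc; _+_; _∸_; _≤ᵇ_; _<ᵇ_; _≡ᵇ_)
open import Data.Bool using (Bool; true; false; _∧_; if_then_else_; T)
open import Data.List using (List; []; _∷_; map; length; upTo; downFrom; foldr; filter)
open import Data.Maybe using (Maybe; just; nothing; _>>=_)
open import Data.Integer using (ℤ; +_; -[1+_]) renaming (_+_ to _+ℤ_; _-_ to _-ℤ_; -_ to -ℤ_)
open import Function using (id)

-- A Dyck path of semilength n is represented by its list of column
-- heights  [h_1, ..., h_n]  (h_i = y-coordinate of the east step in
-- column i).  Such a list comes from a Dyck path iff it has length n,
-- is weakly increasing, and i ≤ h_i ≤ n for every i.
-- ⊥ is represented by 'nothing' in  Maybe (List ℕ).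

nth : List ℕ → ℕ → ℕ
nth []       _       = 0
nth (x ∷ xs) zero    = x
nth (x ∷ xs) (suc k) = nth xs k

setAt : List ℕ → ℕ → ℕ → List ℕ
setAt []       _       _ = []
setAt (x ∷ xs) zero    v = v ∷ xs
setAt (x ∷ xs) (suc k) v = x ∷ setAt xs k v

oneTo : ℕ → List ℕ
oneTo n = map suc (upTo n)

count : (ℕ → Bool) → List ℕ → ℕ
count p []       = 0
count p (x ∷ xs) = if p x then suc (count p xs) else count p xs

height : List ℕ → ℕ → ℕ
height hs zero    = 0
height hs (suc i) = nth hs i

checkH : ℕ → ℕ → ℕ → List ℕ → Bool
checkH n i prev []       = true
checkH n i prev (h ∷ hs) = (prev ≤ᵇ h) ∧ (i ≤ᵇ h) ∧ (h ≤ᵇ n) ∧ checkH n (suc i) h hs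

isDyckH : ℕ → List ℕ → Bool
isDyckH n hs = (length hs ≡ᵇ n) ∧ checkH n 1 0 hs

IsDyck : ℕ → List ℕ → Set
IsDyck n hs = T (isDyckH n hs)

-- validity of a sequence [x_1,...,x_n] of x-coordinates of north steps:
-- weakly increasing and 0 ≤ x_j ≤ j-1
checkX : ℕ → ℕ → List ℕ → Bool
checkX j prev []       = true
checkX j prev (x ∷ xs) = (prev ≤ᵇ x) ∧ (x <ᵇ j) ∧ checkX (suc j) x xs

isDyckX : ℕ → List ℕ → Bool
isDyckX n xs = (length xs ≡ᵇ n) ∧ checkX 1 0 xs

toX : ℕ → List ℕ → List ℕ
toX n hs = map (λ j → count (λ h → h <ᵇ j) hs) (oneTo n)

toH : ℕ → List ℕ → List ℕ
toH n xs = map (λ i → count (λ x → x <ᵇ i) xs) (oneTo n)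

Op : Set
Op = Maybe (List ℕ) → Maybe (List ℕ)

-- composition left to right:  π · (F ⨾ G) = (π · F) · G
_⨾_ : Op → Op → Op
(f ⨾ g) x = g (f x)

iter : ℕ → Op → Op
iter zero    f = id
iter (suc k) f = f ⨾ iter k f

pow : Op → Op → ℤ → Op
pow f finv (+ k)    = iter k f
pow f finv -[1+ k ] = iter (suc k) finv

-- indices outside 1..n give ⊥ (never happens in the uses below)
inRange : ℕ → ℕ → Bool
inRange n i = (1 ≤ᵇ i) ∧ (i ≤ᵇ n)

C : ℕ → ℕ → Op
C n i mp = mp >>= λ hs →
  let hs' = setAt hs (i ∸ 1) (suc (height hs i)) in
  if inRange n i ∧ isDyckH n hs' then just hs' else nothing

Cinv : ℕ → ℕ → Op
Cinv n i mp = mp >>= λ hs →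
  let hs' = setAt hs (i ∸ 1) (height hs i ∸ 1) in
  if inRange n i ∧ (1 ≤ᵇ height hs i) ∧ isDyckH n hs' then just hs' else nothing

A : ℕ → ℕ → Op
A n i mp = mp >>= λ hs →
  let xs  = toX n hs
      xs' = setAt xs (i ∸ 1) (nth xs (i ∸ 1) ∸ 1) in
  if inRange n i ∧ (1 ≤ᵇ nth xs (i ∸ 1)) ∧ isDyckX n xs' then just (toH n xs') else nothing

Ainv : ℕ → ℕ → Op
Ainv n i mp = mp >>= λ hs →
  let xs  = toX n hs
      xs' = setAt xs (i ∸ 1) (suc (nth xs (i ∸ 1))) in
  if inRange n i ∧ isDyckX n xs' then just (toH n xs') else nothing

Cpow : ℕ → ℕ → ℤ → Op
Cpow n i = pow (C n i) (Cinv n i)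

Apow : ℕ → ℕ → ℤ → Op
Apow n i = pow (A n i) (Ainv n i)

bounceGo : ℕ → ℕ → List ℕ → ℕ → List ℕ
bounceGo zero       n hs b = b ∷ []
bounceGo (suc fuel) n hs b =
  if b ≡ᵇ n then b ∷ [] else b ∷ bounceGo fuel n hs (height hs (suc b))

bounces : ℕ → List ℕ → List ℕ
bounces n hs = bounceGo (suc n) n hs 0

bp : ℕ → List ℕ → ℕ → ℕ
bp n hs k = nth (bounces n hs) k

bm : ℕ → List ℕ → ℕ
bm n hs = length (bounces n hs) ∸ 1

U : ℕ → ℕ → List ℕ → Maybe (List ℕ)
U n i hs =
  let m   = bm n hs
      bi  = bp n hs i
      bi- = bp n hs (i ∸ 1)
      bi+ = bp n hs (suc i)
      u   = if i ≡ᵇ m then 0 else bi+ ∸ height hs bi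
      β   = λ j → ((+ height hs (bi- + u + 2 ∸ j)) -ℤ (+ bi)) +ℤ (+ 1)
      -- C_{b_{i-1}+2}^{-β_u} ⋯ C_{b_{i-1}+1+u}^{-β_1}  (j = u, u-1, …, 1)
      Cs  = foldr _⨾_ id (map (λ j → Cpow n (bi- + u + 2 ∸ j) (-ℤ (β j))) (map suc (downFrom u)))
      -- A_{b_{i+1}-u+1}^{β_1} ⋯ A_{b_{i+1}}^{β_u}  (k = 1, …, u)
      As  = foldr _⨾_ id (map (λ k → Apow n (bi+ ∸ u + k) (β k)) (oneTo u))
  in if height hs bi- ≡ᵇ bi
     then nothing
     else (Cinv n (bi- + 1) ⨾ (Cs ⨾ As)) (just hs)

{-# OPTIONS --safe #-}
-- When column b_i reaches height b_{i+1}, the parameter u of U_i is 0, so U_i is the single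
-- step C_{b_{i-1}+1}^{-1} (or ⊥ if column b_{i-1} reaches b_i as well).  Descend from i to the
-- first j whose predecessor column b_{j-1} does not reach b_j; j = 1 qualifies since h_0 = 0 < b_1.
-- Column b_{j-1}+1 has height b_j, and lowering it by one keeps the path Dyck: it stays above
-- h_{b_{j-1}} < b_j, and above the diagonal because b_j ≥ b_{j-1} + 2, for if b_j = b_{j-1} + 1
-- then h_{b_j} = b_j, whereas h_{b_j} = b_{j+1} > b_j.
module Submission where

open import Defs
open import Data.Nat using (ℕ; zero; suc; _≤_; _<_; _+_; _∸_; _≡ᵇ_; _≤ᵇ_; z≤n; s≤s)
open import Data.Nat.Properties
open import Data.Bool using (T; true; false; _∧_; if_then_else_)
open import Data.Bool.Properties using (T-∧; if-eta)
open import Data.List using (List; []; _∷_; length)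
open import Data.Maybe using (nothing; just)
open import Data.Product using (Σ; _×_; _,_; proj₁; proj₂)
open import Function.Bundles using (_⇔_; mk⇔; module Equivalence)
open import Relation.Nullary using (¬_; yes; no)
open import Relation.Nullary.Decidable using (dec-false)
open import Relation.Binary.PropositionalEquality

open Equivalence using (to; from)
open ≡-Reasoning

-- The entries of hs are the heights of columns i, i+1, …, and p is the height of column i-1.
data HeightsFrom (n : ℕ) : ℕ → ℕ → List ℕ → Set where
  []   : ∀ {i p} → HeightsFrom n i p []
  cons : ∀ {i p x xs} → p ≤ x → i ≤ x → x ≤ n → HeightsFrom n (suc i) x xs →
         HeightsFrom n i p (x ∷ xs)

module _ {n : ℕ} where

  checkH-sound : ∀ {i p} hs → T (checkH n i p hs) → HeightsFrom n i p hs
  checkH-sound         []       _ = []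
  checkH-sound {i} {p} (x ∷ xs) t =
    let p≤x , t₁ = to T-∧ t ; i≤x , t₂ = to T-∧ t₁ ; x≤n , rest = to T-∧ t₂
    in cons (≤ᵇ⇒≤ p x p≤x) (≤ᵇ⇒≤ i x i≤x) (≤ᵇ⇒≤ x n x≤n) (checkH-sound xs rest)

  checkH-complete : ∀ {i p hs} → HeightsFrom n i p hs → T (checkH n i p hs)
  checkH-complete []                       = _
  checkH-complete (cons p≤x i≤x x≤n rest) =
    from T-∧ (≤⇒≤ᵇ p≤x , from T-∧ (≤⇒≤ᵇ i≤x , from T-∧ (≤⇒≤ᵇ x≤n , checkH-complete rest)))

  HeightsFrom-≤ : ∀ {i p hs} → HeightsFrom n i p hs → ∀ k → nth hs k ≤ n
  HeightsFrom-≤ []                   _       = z≤n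
  HeightsFrom-≤ (cons _ _ x≤n _)    zero    = x≤n
  HeightsFrom-≤ (cons _ _ _   rest) (suc k) = HeightsFrom-≤ rest k

  HeightsFrom-index≤ : ∀ {i p hs} → HeightsFrom n i p hs → ∀ {k} → k < length hs → i + k ≤ nth hs k
  HeightsFrom-index≤ {i} (cons {x = x} _ i≤x _ _) {zero} _ = subst (_≤ x) (sym (+-identityʳ i)) i≤x
  HeightsFrom-index≤ {i} (cons {xs = xs} _ _ _ rest) {suc k} (s≤s k<l) =
    subst (_≤ nth xs k) (sym (+-suc i k)) (HeightsFrom-index≤ rest k<l)

  HeightsFrom-prev≤ : ∀ {i p hs} → HeightsFrom n i p hs → ∀ {k} → k < length hs →
                      nth (p ∷ hs) k ≤ nth hs k
  HeightsFrom-prev≤ (cons p≤x _ _ _)    {zero}  _         = p≤x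
  HeightsFrom-prev≤ (cons _   _ _ rest) {suc k} (s≤s k<l) = HeightsFrom-prev≤ rest k<l

  HeightsFrom-relax : ∀ {i p q hs} → q ≤ p → HeightsFrom n i p hs → HeightsFrom n i q hs
  HeightsFrom-relax _   []                       = []
  HeightsFrom-relax q≤p (cons p≤x i≤x x≤n rest) = cons (≤-trans q≤p p≤x) i≤x x≤n rest

  HeightsFrom-setAt : ∀ {i p hs} → HeightsFrom n i p hs → ∀ k {v} →
                      nth (p ∷ hs) k ≤ v → i + k ≤ v → v ≤ nth hs k →
                      HeightsFrom n i p (setAt hs k v)
  HeightsFrom-setAt []                          _           _      _   _   = []
  HeightsFrom-setAt {i} (cons _ _ x≤n rest)     zero        p≤v    i≤v v≤x =
    cons p≤v (subst (_≤ _) (+-identityʳ i) i≤v) (≤-trans v≤x x≤n) (HeightsFrom-relax v≤x rest)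
  HeightsFrom-setAt {i} (cons p≤x i≤x x≤n rest) (suc k) {v} prev≤v i≤v v≤x =
    cons p≤x i≤x x≤n (HeightsFrom-setAt rest k prev≤v (subst (_≤ v) (+-suc i k) i≤v) v≤x)

if-just≢nothing : ∀ {A : Set} {b} {x : A} → T b → (if b then just x else nothing) ≢ nothing
if-just≢nothing {b = true} _ ()

length-setAt : ∀ hs k v → length (setAt hs k v) ≡ length hs
length-setAt []       _       _ = refl
length-setAt (x ∷ xs) zero    _ = refl
length-setAt (x ∷ xs) (suc k) v = cong suc (length-setAt xs k v)

height-as-nth : ∀ hs c → height hs c ≡ nth (0 ∷ hs) c
height-as-nth _ zero    = refl
height-as-nth _ (suc _) = refl

IsDyck⇔ : ∀ {n hs} → IsDyck n hs ⇔ (length hs ≡ n × HeightsFrom n 1 0 hs)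
IsDyck⇔ {n} {hs} = mk⇔
  (λ d → let l≡n , valid = to T-∧ d in ≡ᵇ⇒≡ (length hs) n l≡n , checkH-sound hs valid)
  (λ (l≡n , valid) → from T-∧ (≡⇒≡ᵇ (length hs) n l≡n , checkH-complete valid))

bounceGo-head : ∀ fuel n hs b → nth (bounceGo fuel n hs b) 0 ≡ b
bounceGo-head zero       n hs b = refl
bounceGo-head (suc fuel) n hs b with b ≡ᵇ n
... | true  = refl
... | false = refl

bounceGo-step : ∀ fuel n hs b k → suc k < length (bounceGo fuel n hs b) →
                let bs = bounceGo fuel n hs b in
                nth bs k ≢ n × nth bs (suc k) ≡ height hs (suc (nth bs k))
bounceGo-step zero       n hs b k (s≤s ())
bounceGo-step (suc fuel) n hs b k k<l with b ≡ᵇ n in b≡ᵇn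
bounceGo-step (suc fuel) n hs b k       (s≤s ())  | true
bounceGo-step (suc fuel) n hs b zero    _         | false =
  (λ b≡n → subst T b≡ᵇn (≡⇒≡ᵇ b n b≡n)) , bounceGo-head fuel n hs (height hs (suc b))
bounceGo-step (suc fuel) n hs b (suc k) (s≤s k<l) | false =
  bounceGo-step fuel n hs (height hs (suc b)) k k<l

bounce-zero : ∀ n hs → bp n hs 0 ≡ 0
bounce-zero n hs = bounceGo-head (suc n) n hs 0

bounce-step : ∀ n hs k → suc k ≤ bm n hs →
              bp n hs k ≢ n × bp n hs (suc k) ≡ height hs (suc (bp n hs k))
bounce-step n hs k k<m = bounceGo-step (suc n) n hs 0 k (pred-cancel-< {m = suc k} k<m)

ReachesNextBounce : ℕ → List ℕ → ℕ → Set
ReachesNextBounce n hs j = height hs (bp n hs j) ≡ bp n hs (suc j)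

U-≡-Cinv : ∀ n hs k → ReachesNextBounce n hs (suc k) → ¬ ReachesNextBounce n hs k →
           U n (suc k) hs ≡ Cinv n (suc (bp n hs k)) (just hs)
U-≡-Cinv n hs k reach ¬reach
  rewrite reach | n∸n≡0 (bp n hs (suc (suc k))) | if-eta (suc k ≡ᵇ bm n hs) {0}
        | dec-false (height hs (bp n hs k) ≟ bp n hs (suc k)) ¬reach
        | +-comm (bp n hs k) 1
        = refl

module DyckPath {n : ℕ} {hs : List ℕ} (dyck : IsDyck n hs) where

  private
    H B : ℕ → ℕ
    H = height hs
    B = bp n hs

  length≡n : length hs ≡ n
  length≡n = proj₁ (to (IsDyck⇔ {n} {hs}) dyck)

  heights : HeightsFrom n 1 0 hs
  heights = proj₂ (to (IsDyck⇔ {n} {hs}) dyck)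

  height-≤ : ∀ c → H c ≤ n
  height-≤ zero    = z≤n
  height-≤ (suc c) = HeightsFrom-≤ heights c

  height-above-diagonal : ∀ {c} → c < n → suc c ≤ H (suc c)
  height-above-diagonal c<n = HeightsFrom-index≤ heights (subst (_ <_) (sym length≡n) c<n)

  height-mono : ∀ {c} → c < n → H c ≤ H (suc c)
  height-mono {c} c<n = subst (_≤ H (suc c)) (sym (height-as-nth hs c))
    (HeightsFrom-prev≤ heights (subst (_ <_) (sym length≡n) c<n))

  lower-column : ∀ c {v} → H c ≤ v → suc c ≤ v → v ≤ H (suc c) → IsDyck n (setAt hs c v)
  lower-column c {v} hc≤v c<v v≤h = from (IsDyck⇔ {n} {setAt hs c v})
    ( trans (length-setAt hs c v) length≡n
    , HeightsFrom-setAt heights c (subst (_≤ v) (height-as-nth hs c) hc≤v) c<v v≤h )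

  Cinv-defined : ∀ {c} → c < n → H c < H (suc c) → suc c < H (suc c) → Cinv n (suc c) (just hs) ≢ nothing
  Cinv-defined {c} c<n hc<h c<h = if-just≢nothing defined
    where
      defined : T (inRange n (suc c) ∧ (1 ≤ᵇ H (suc c)) ∧ isDyckH n (setAt hs c (H (suc c) ∸ 1)))
      defined = from T-∧ ( ≤⇒≤ᵇ c<n
                         , from T-∧ ( ≤⇒≤ᵇ (≤-trans (s≤s z≤n) c<h)
                                    , lower-column c (<⇒≤pred hc<h) (<⇒≤pred c<h) pred[n]≤n ))

  bounce-≤n : ∀ k → k ≤ bm n hs → B k ≤ n
  bounce-≤n zero    _   = subst (_≤ n) (sym (bounce-zero n hs)) z≤n
  bounce-≤n (suc k) k<m = subst (_≤ n) (sym (proj₂ (bounce-step n hs k k<m))) (height-≤ _)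

  bounce-<n : ∀ k → suc k ≤ bm n hs → B k < n
  bounce-<n k k<m = ≤∧≢⇒< (bounce-≤n k (<⇒≤ k<m)) (proj₁ (bounce-step n hs k k<m))

  bounce-< : ∀ k → suc k ≤ bm n hs → B k < B (suc k)
  bounce-< k k<m = subst (B k <_) (sym (proj₂ (bounce-step n hs k k<m)))
                         (height-above-diagonal (bounce-<n k k<m))

  bounce₀-not-reaching : 1 ≤ bm n hs → ¬ ReachesNextBounce n hs 0
  bounce₀-not-reaching 0<m reach =
    n≮0 (subst (B 0 <_) (trans (sym reach) (cong H (bounce-zero n hs))) (bounce-< 0 0<m))

  U-defined : ∀ k → suc (suc k) ≤ bm n hs → ReachesNextBounce n hs (suc k) →
              ¬ ReachesNextBounce n hs k → U n (suc k) hs ≢ nothing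
  U-defined k k<m reach ¬reach =
    subst (_≢ nothing) (sym (U-≡-Cinv n hs k reach ¬reach)) (Cinv-defined b<n Hb<Hb′ b′<Hb′)
    where
      b c : ℕ
      b = B k
      c = B (suc k)
      c≡ : c ≡ H (suc b)
      c≡ = proj₂ (bounce-step n hs k (<⇒≤ k<m))
      b<n : b < n
      b<n = bounce-<n k (<⇒≤ k<m)
      Hb<Hb′ : H b < H (suc b)
      Hb<Hb′ = ≤∧≢⇒< (height-mono b<n) (λ eq → ¬reach (trans eq (sym c≡)))
      c<Hc : c < H c
      c<Hc = subst (c <_) (sym reach) (bounce-< (suc k) k<m)
      b′<Hb′ : suc b < H (suc b)
      b′<Hb′ = ≤∧≢⇒< (height-above-diagonal b<n) (λ b′≡Hb′ → <-irrefl (sym (Hc≡c b′≡Hb′)) c<Hc)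
        where
          Hc≡c : suc b ≡ H (suc b) → H c ≡ c
          Hc≡c b′≡Hb′ = begin
            H c        ≡⟨ cong H (trans c≡ (sym b′≡Hb′)) ⟩
            H (suc b)  ≡⟨ sym c≡ ⟩
            c          ∎

  U-defined-at-or-below : ∀ k → suc (suc k) ≤ bm n hs → ReachesNextBounce n hs (suc k) →
                          Σ ℕ (λ j → (1 ≤ j) × (j ≤ suc k) × (U n j hs ≢ nothing))
  U-defined-at-or-below zero k<m reach =
    1 , ≤-refl , ≤-refl , U-defined 0 k<m reach (bounce₀-not-reaching (<⇒≤ k<m))
  U-defined-at-or-below (suc k) k<m reach with H (B (suc k)) ≟ B (suc (suc k))
  ... | yes reach′ = let j , 1≤j , j≤k , defined = U-defined-at-or-below k (<⇒≤ k<m) reach′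
                     in j , 1≤j , m≤n⇒m≤1+n j≤k , defined
  ... | no ¬reach  = suc (suc k) , s≤s z≤n , ≤-refl , U-defined (suc k) k<m reach ¬reach

lemma4p6 : (n : ℕ) (hs : List ℕ) → IsDyck n hs →
    (i : ℕ) → 1 ≤ i → suc i ≤ bm n hs →
    height hs (bp n hs i) ≡ bp n hs (suc i) →
    Σ ℕ (λ j → (1 ≤ j) × (j ≤ i) × (U n j hs ≢ nothing))
lemma4p6 n hs dyck zero    ()
lemma4p6 n hs dyck (suc i) _ i<m reach = DyckPath.U-defined-at-or-below dyck i i<m reach
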